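{- Let $f:2^V\to\mathbb{R}_{\ge 0}$ be a monotone submodular function and $T=\{t_1,\dots,t_k\}\subseteq V$ a set of $k$ elements. Let $\mathrm{OPT}=\min\{\sum_{i=1}^k f(V_i): V_1,\dots,V_k \text{ is a partition of } V \text{ with } t_i\in V_i\ \forall i\in[k]\}$. If the terminals are ordered so that $f(\{t_1\})\le f(\{t_2\})\le\dots\le f(\{t_k\})$, then $$f\big((V\setminus T)\cup\{t_k\}\big)+\sum_{i=1}^{k-1} f(\{t_i\})\le\Big(2-\frac1k\Big)\mathrm{OPT}.$$
   Context: $f$ is monotone if $f(A)\le f(B)$ for $A\subseteq B$, and submodular if $f(A)+f(B)\ge f(A\cap B)+f(A\cup B)$ for all $A,B\subseteq V$.
   Formalization: The function f takes values in the nonnegative rationals rather than in $\mathbb{R}_{\ge 0}$. -}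

module Defs where

open import Data.Nat using (ℕ; zero; suc)
open import Data.Fin using (Fin; zero; suc)
open import Data.Fin.Subset using (Subset; _⊆_; _∩_; _∪_; ∁; ⁅_⁆; _∈_)
import Data.Fin.Subset as S
open import Data.Rational using (ℚ; 0ℚ; _+_; _≤_)
open import Data.Product using (∃; _×_)
open import Relation.Binary.PropositionalEquality using (_≡_)

Σℚ : {k : ℕ} → (Fin k → ℚ) → ℚ
Σℚ {zero}  g = 0ℚ
Σℚ {suc k} g = g zero + Σℚ (λ i → g (suc i))

⋃ᶠ : {n k : ℕ} → (Fin k → Subset n) → Subset n
⋃ᶠ {n} {zero}  A = S.⊥
⋃ᶠ {n} {suc k} A = A zero ∪ ⋃ᶠ (λ i → A (suc i))

SetFn : ℕ → Set
SetFn n = Subset n → ℚ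

NonNegative : {n : ℕ} → SetFn n → Set
NonNegative f = ∀ A → 0ℚ ≤ f A

Monotone : {n : ℕ} → SetFn n → Set
Monotone f = ∀ A B → A ⊆ B → f A ≤ f B

Submodular : {n : ℕ} → SetFn n → Set
Submodular f = ∀ A B → f (A ∩ B) + f (A ∪ B) ≤ f A + f B

IsPartition : {n k : ℕ} → (Fin k → Subset n) → Set
IsPartition {n} {k} P =
  (∀ (x : Fin n) → ∃ λ (i : Fin k) → x ∈ P i) × (∀ (x : Fin n) (i j : Fin k) → x ∈ P i → x ∈ P j → i ≡ j)

-- A nonnegative submodular f is subadditive, so by monotonicity every set, in particular
-- (V ∖ T) ∪ {t_k}, costs at most f(V) ≤ Σᵢ f(Vᵢ) = OPT. Since tᵢ ∈ Vᵢ, also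
-- Σᵢ f({tᵢ}) ≤ OPT. The largest of these k values is f({t_k}), so it is at least their mean,
-- and the remaining k - 1 values add up to at most (1 - 1/k) Σᵢ f({tᵢ}) ≤ (1 - 1/k) OPT.
module Submission where

open import Defs
open import Data.Nat using (ℕ; suc)
open import Data.Fin using (Fin; fromℕ; inject₁)
import Data.Fin as F
open import Data.Fin.Subset using (Subset; _∪_; ∁; ⁅_⁆; _∈_)
open import Data.Rational using (ℚ; _+_; _-_; _*_; _≤_; _/_)
open import Data.Integer using (+_)
open import Function.Definitions using (Injective)
open import Relation.Binary.PropositionalEquality using (_≡_)

import Data.Integer as ℤ
import Data.Integer.Properties as ℤₚ
import Data.Nat.Coprimality as Coprimality
open import Data.Nat using (zero)
open import Data.Fin using (zero; suc)
open import Data.Fin.Properties using (≤fromℕ)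
open import Data.Fin.Subset using (_⊆_; _∩_)
open import Data.Fin.Subset.Properties using (x∈p∪q⁺; x∈⁅y⁆⇒x≡y; ∪-identityʳ)
open import Data.Product using (∃; _,_; proj₁)
open import Data.Sum using (inj₁; inj₂)
open import Data.Rational using (0ℚ; 1ℚ; mkℚ) renaming (NonNegative to NonNegativeℚ)
open import Data.Rational.Properties
open import Data.Rational.Solver using (module +-*-Solver)
open import Function using (_∘_)
open import Relation.Binary.PropositionalEquality using (refl; sym; trans; cong; subst)

open +-*-Solver
open ≤-Reasoning

Σℚ-mono : ∀ {k} {g h : Fin k → ℚ} → (∀ i → g i ≤ h i) → Σℚ g ≤ Σℚ h
Σℚ-mono {zero}  g≤h = ≤-refl
Σℚ-mono {suc k}  g≤h = +-mono-≤ (g≤h zero) (Σℚ-mono (g≤h ∘ suc))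

Σℚ-init-last : ∀ m (g : Fin (suc m) → ℚ) → Σℚ g ≡ Σℚ (g ∘ inject₁) + g (fromℕ m)
Σℚ-init-last zero    g = +-comm (g zero) 0ℚ
Σℚ-init-last (suc m) g =
  trans (cong (λ s → g zero + s) (Σℚ-init-last m (g ∘ suc))) (sym (+-assoc (g zero) _ _))

toℚ : ℕ → ℚ
toℚ j = + j / 1

toℚ≡mkℚ : ∀ j → toℚ j ≡ mkℚ (+ j) 0 (Coprimality.sym (Coprimality.1-coprimeTo j))
toℚ≡mkℚ j = normalize-coprime (Coprimality.sym (Coprimality.1-coprimeTo j))

toℚ-suc : ∀ j → toℚ (suc j) ≡ 1ℚ + toℚ j
toℚ-suc j rewrite toℚ≡mkℚ j =
  sym (/-cong {p₂ = + suc j} (cong (λ z → + 1 ℤ.+ z) (ℤₚ.*-identityʳ (+ j))) refl)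

Σℚ-const : ∀ k x → Σℚ {k} (λ _ → x) ≡ toℚ k * x
Σℚ-const zero    x = sym (*-zeroˡ x)
Σℚ-const (suc k) x = begin-equality
  x + Σℚ {k} (λ _ → x) ≡⟨ cong (λ s → x + s) (Σℚ-const k x) ⟩
  x + toℚ k * x        ≡⟨ solve 2 (λ x t → x :+ t :* x := (con 1ℚ :+ t) :* x) refl x (toℚ k) ⟩
  (1ℚ + toℚ k) * x     ≡⟨ cong (_* x) (toℚ-suc k) ⟨
  toℚ (suc k) * x      ∎

1/k*k≡1 : ∀ m → (+ 1 / suc m) * toℚ (suc m) ≡ 1ℚ
1/k*k≡1 m rewrite toℚ≡mkℚ (suc m) | normalize-coprime {1} {m} (Coprimality.1-coprimeTo (suc m)) =
  *-inverseˡ (mkℚ (+ suc m) 0 (Coprimality.sym (Coprimality.1-coprimeTo (suc m))))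

1-1/k-nonNeg : ∀ m → NonNegativeℚ (1ℚ - + 1 / suc m)
1-1/k-nonNeg m = subst NonNegativeℚ (sym 1-c≡c*m) c*m-nonNeg
  where
  c = + 1 / suc m
  instance
    c-nonNeg : NonNegativeℚ c
    c-nonNeg = normalize-nonNeg 1 (suc m)
    m-nonNeg : NonNegativeℚ (toℚ m)
    m-nonNeg = normalize-nonNeg m 1
  c*m-nonNeg : NonNegativeℚ (c * toℚ m)
  c*m-nonNeg = nonNeg*nonNeg⇒nonNeg c (toℚ m)
  1-c≡c*m : 1ℚ - c ≡ c * toℚ m
  1-c≡c*m = begin-equality
    1ℚ - c                 ≡⟨ cong (_- c) (trans (sym (1/k*k≡1 m)) (cong (c *_) (toℚ-suc m))) ⟩
    c * (1ℚ + toℚ m) - c   ≡⟨ solve 2 (λ c t → c :* (con 1ℚ :+ t) :- c := c :* t) refl c (toℚ m) ⟩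
    c * toℚ m              ∎

Σℚ-init≤[1-1/k]*Σℚ : ∀ m (g : Fin (suc m) → ℚ) → (∀ i → g i ≤ g (fromℕ m))
  → Σℚ (g ∘ inject₁) ≤ (1ℚ - + 1 / suc m) * Σℚ g
Σℚ-init≤[1-1/k]*Σℚ m g g≤last = begin
  init               ≡⟨ solve 2 (λ s l → (s :+ l) :- l := s) refl init last ⟨
  init + last - last ≡⟨ cong (_- last) (Σℚ-init-last m g) ⟨
  Σℚ g - last        ≤⟨ +-monoʳ-≤ (Σℚ g) (neg-antimono-≤ mean≤last) ⟩
  Σℚ g - c * Σℚ g    ≡⟨ solve 2 (λ s c → s :- c :* s := (con 1ℚ :- c) :* s) refl (Σℚ g) c ⟩
  (1ℚ - c) * Σℚ g    ∎
  where
  c = + 1 / suc m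
  init = Σℚ (g ∘ inject₁)
  last = g (fromℕ m)
  instance
    c-nonNeg : NonNegativeℚ c
    c-nonNeg = normalize-nonNeg 1 (suc m)
  mean≤last : c * Σℚ g ≤ last
  mean≤last = begin
    c * Σℚ g                           ≤⟨ *-monoˡ-≤-nonNeg c (Σℚ-mono g≤last) ⟩
    c * Σℚ {suc m} (λ _ → last)        ≡⟨ cong (c *_) (Σℚ-const (suc m) last) ⟩
    c * (toℚ (suc m) * last)           ≡⟨ *-assoc c (toℚ (suc m)) last ⟨
    (c * toℚ (suc m)) * last           ≡⟨ cong (_* last) (1/k*k≡1 m) ⟩
    1ℚ * last                          ≡⟨ *-identityˡ last ⟩
    last                               ∎

module _ {n : ℕ} {f : SetFn n} (f≥0 : NonNegative f) (sub : Submodular f) where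

  subadditive : ∀ A B → f (A ∪ B) ≤ f A + f B
  subadditive A B = begin
    f (A ∪ B)             ≡⟨ +-identityˡ (f (A ∪ B)) ⟨
    0ℚ + f (A ∪ B)        ≤⟨ +-monoˡ-≤ (f (A ∪ B)) (f≥0 (A ∩ B)) ⟩
    f (A ∩ B) + f (A ∪ B) ≤⟨ sub A B ⟩
    f A + f B             ∎

  subadditive-⋃ᶠ : ∀ {k} (A : Fin (suc k) → Subset n) → f (⋃ᶠ A) ≤ Σℚ (f ∘ A)
  subadditive-⋃ᶠ {zero}  A =
    ≤-reflexive (trans (cong f (∪-identityʳ (A zero))) (sym (+-identityʳ (f (A zero)))))
  subadditive-⋃ᶠ {suc k}  A =
    ≤-trans (subadditive (A zero) _) (+-monoʳ-≤ (f (A zero)) (subadditive-⋃ᶠ (A ∘ suc)))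

∈⋃ᶠ : ∀ {n k} (A : Fin k → Subset n) {x} i → x ∈ A i → x ∈ ⋃ᶠ A
∈⋃ᶠ A zero    x∈A = x∈p∪q⁺ (inj₁ x∈A)
∈⋃ᶠ A (suc i) x∈A = x∈p∪q⁺ (inj₂ (∈⋃ᶠ (A ∘ suc) i x∈A))

x∈p⇒⁅x⁆⊆p : ∀ {n} {x : Fin n} {p : Subset n} → x ∈ p → ⁅ x ⁆ ⊆ p
x∈p⇒⁅x⁆⊆p {p = p} x∈p y∈⁅x⁆ = subst (_∈ p) (sym (x∈⁅y⁆⇒x≡y _ y∈⁅x⁆)) x∈p

cover⇒f≤Σℚ : ∀ {n k} {f : SetFn n} → NonNegative f → Monotone f → Submodular f
  → (P : Fin (suc k) → Subset n) → (∀ x → ∃ λ i → x ∈ P i) → ∀ X → f X ≤ Σℚ (f ∘ P)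
cover⇒f≤Σℚ {f = f} f≥0 mono sub P covers X =
  ≤-trans (mono X (⋃ᶠ P) X⊆⋃P) (subadditive-⋃ᶠ f≥0 sub P)
  where
  X⊆⋃P : X ⊆ ⋃ᶠ P
  X⊆⋃P {x} _ = let i , x∈P = covers x in ∈⋃ᶠ P i x∈P

proposition2p1 : (n m : ℕ) (f : SetFn n) → NonNegative f → Monotone f → Submodular f
    → (t : Fin (suc m) → Fin n) → Injective _≡_ _≡_ t
    → (∀ (i j : Fin (suc m)) → i F.≤ j → f ⁅ t i ⁆ ≤ f ⁅ t j ⁆)
    → (P : Fin (suc m) → Subset n) → IsPartition P → (∀ i → t i ∈ P i)
    → f (∁ (⋃ᶠ (λ i → ⁅ t i ⁆)) ∪ ⁅ t (fromℕ m) ⁆) + Σℚ (λ (i : Fin m) → f ⁅ t (inject₁ i) ⁆)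
    ≤ ((+ 2 / 1) - (+ 1 / suc m)) * Σℚ (λ i → f (P i))
proposition2p1 n m f f≥0 mono sub t _ sorted P partition t∈P = begin
  f X + Σℚ (a ∘ inject₁)   ≤⟨ +-mono-≤ (cover⇒f≤Σℚ f≥0 mono sub P (proj₁ partition) X)
                                        (Σℚ-init≤[1-1/k]*Σℚ m a (λ i → sorted i (fromℕ m) (≤fromℕ i))) ⟩
  OPT + (1ℚ - c) * Σℚ a    ≤⟨ +-monoʳ-≤ OPT (*-monoˡ-≤-nonNeg (1ℚ - c) Σa≤OPT) ⟩
  OPT + (1ℚ - c) * OPT     ≡⟨ solve 2 (λ o c → o :+ (con 1ℚ :- c) :* o := ((con 1ℚ :+ con 1ℚ) :- c) :* o)
                                      refl OPT c ⟩
  ((+ 2 / 1) - c) * OPT    ∎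
  where
  X = ∁ (⋃ᶠ (λ i → ⁅ t i ⁆)) ∪ ⁅ t (fromℕ m) ⁆
  a = λ i → f ⁅ t i ⁆
  c = + 1 / suc m
  OPT = Σℚ (f ∘ P)
  instance
    1-c-nonNeg : NonNegativeℚ (1ℚ - c)
    1-c-nonNeg = 1-1/k-nonNeg m
  Σa≤OPT : Σℚ a ≤ OPT
  Σa≤OPT = Σℚ-mono (λ i → mono _ _ (x∈p⇒⁅x⁆⊆p (t∈P i)))
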